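{- Let $n$ be a natural number ($n\ge0$). The map $\sup^n:\mathsf{T}^n_U V^n\to V^n$ is an equivalence; in particular $V^n\simeq \mathsf{T}^n_U V^n$, i.e. $V^n$ is a fixed point of $\mathsf{T}^n_U$.
   Context: Homotopy type theory with univalent universes $U:\mathsf{Type}$ and function extensionality. A map is $k$-truncated if its homotopy fibers are $k$-types; $A\hookrightarrow_k X$ is the type of $k$-truncated maps. $\mathsf{T}^n_U X:=\sum_{A:U}(A\hookrightarrow_{n-1}X)$. Let $V^\infty:=W_{A:U}A$ (the W-type with constructor $\sup^\infty:\sum_{A:U}(A\to V^\infty)\to V^\infty$). For $k\ge-1$ define inductively the proposition $\mathrm{isIt}_k(\sup^\infty(A,f)):=(f\text{ is }k\text{ -truncated})\times\prod_{a:A}\mathrm{isIt}_k(f\,a)$ and $V^{k+1}:=\sum_{x:V^\infty}\mathrm{isIt}_k\,x$. Define $\sup^n(A,f):=(\sup^\infty(A,\pi_0\circ f),-)$ for $A:U$, $f:A\hookrightarrow_{n-1}V^n$ (the remaining component is a proof of a proposition). -}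

{-# OPTIONS --without-K #-}
module Defs where

open import Level using (Level; _⊔_; Setω) renaming (suc to lsuc)
open import Data.Nat using (ℕ; zero; suc)
open import Data.Product using (Σ; _×_; _,_; proj₁; proj₂)
open import Relation.Binary.PropositionalEquality
  using (_≡_; refl; sym; trans; cong; subst)
open import Axiom.Extensionality.Propositional using (Extensionality)

private variable
  a b : Level

isContr : Set a → Set a
isContr A = Σ A λ c → ∀ x → c ≡ x

-- isOfHLevel h A  :  A is an (h-2)-type.  So "k-type" (k ≥ -2) is isOfHLevel (k+2).
isOfHLevel : ℕ → Set a → Set a
isOfHLevel zero    A = isContr A
isOfHLevel (suc h) A = (x y : A) → isOfHLevel h (x ≡ y)

isProp : Set a → Set a
isProp A = (x y : A) → x ≡ y

fiber : {A : Set a} {B : Set b} → (A → B) → B → Set (a ⊔ b)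
fiber {A = A} f y = Σ A λ x → f x ≡ y

isEquiv : {A : Set a} {B : Set b} → (A → B) → Set (a ⊔ b)
isEquiv f = ∀ y → isContr (fiber f y)

_≃_ : Set a → Set b → Set (a ⊔ b)
A ≃ B = Σ (A → B) isEquiv

isTruncMap : ℕ → {A : Set a} {B : Set b} → (A → B) → Set (a ⊔ b)
isTruncMap h f = ∀ y → isOfHLevel h (fiber f y)

-- A ↪[ h ] X : the type of (h-2)-truncated maps.  Paper's  A ↪_k X  is  A ↪[ k + 2 ] X.
_↪[_]_ : Set a → ℕ → Set b → Set (a ⊔ b)
A ↪[ h ] X = Σ (A → X) (isTruncMap h)

idtoeqv : {A B : Set a} → A ≡ B → A ≃ B
idtoeqv {A = A} refl = (λ x → x) , λ y → (y , refl) , λ { (x , refl) → refl }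

Univalence : (a : Level) → Set (lsuc a)
Univalence a = (A B : Set a) → isEquiv (idtoeqv {A = A} {B = B})

FunExt : Setω
FunExt = ∀ {a b} → Extensionality a b

-- The universe U is  Set ℓ.  V∞ = W_{A:U} A

data V∞ (ℓ : Level) : Set (lsuc ℓ) where
  sup∞ : (A : Set ℓ) → (A → V∞ ℓ) → V∞ ℓ

-- isIt' h x : the paper's isIt_k x for k = h - 2 (so h = k + 2, h ≥ 1 ⇔ k ≥ -1)
-- We index by n : ℕ with h = suc n, i.e. isItN n = isIt_{n-1}.
isItN : {ℓ : Level} → ℕ → V∞ ℓ → Set (lsuc ℓ)
isItN n (sup∞ A f) = isTruncMap (suc n) f × ((x : A) → isItN n (f x))

V : {ℓ : Level} → ℕ → Set (lsuc ℓ)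
V {ℓ} n = Σ (V∞ ℓ) (isItN n)

T : {ℓ b : Level} → ℕ → Set b → Set (lsuc ℓ ⊔ b)
T {ℓ} {b} n X = Σ (Set ℓ) λ A → A ↪[ suc n ] X

private
  _∙_ : {A : Set a} {x y z : A} → x ≡ y → y ≡ z → x ≡ z
  _∙_ = trans

  ∙-refl : {A : Set a} {x y : A} (p : x ≡ y) → trans p refl ≡ p
  ∙-refl refl = refl

  retract-hlevel : ∀ {A : Set a} {B : Set b} (h : ℕ) (r : A → B) (s : B → A)
    → (∀ y → r (s y) ≡ y) → isOfHLevel h A → isOfHLevel h B
  retract-hlevel zero r s ε (c , k) = r c , λ y → trans (cong r (k (s y))) (ε y)
  retract-hlevel (suc h) r s ε H x y =
    retract-hlevel h
      (λ p → trans (sym (ε x)) (trans (cong r p) (ε y)))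
      (cong s)
      (λ { refl → lem (ε x) })
      (H (s x) (s y))
    where
      lem : ∀ {z w} (e : z ≡ w) → trans (sym e) (trans refl e) ≡ refl
      lem refl = refl

  contr→prop : {A : Set a} → isContr A → isProp A
  contr→prop (c , k) x y = trans (sym (k x)) (k y)

  -- paths in a proposition: every path equals a canonical one
  prop→set : {A : Set a} → isProp A → (x y : A) → isProp (x ≡ y)
  prop→set {A = A} P x y p q = trans (sym (lem p)) (lem q)
    where
      lem : ∀ {z} (p : x ≡ z) → trans (sym (P x x)) (P x z) ≡ p
      lem refl = lem0 (P x x)
        where
          lem0 : ∀ {w} (e : x ≡ w) → trans (sym e) e ≡ refl
          lem0 refl = refl

  prop-hlevel : {A : Set a} (n : ℕ) → isProp A → isOfHLevel (suc n) A
  prop-hlevel zero P x y = P x y , prop→set P x y (P x y)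
  prop-hlevel (suc n) P x y = prop-hlevel n (prop→set P x y)

  isOfHLevel-suc : {A : Set a} (h : ℕ) → isOfHLevel h A → isOfHLevel (suc h) A
  isOfHLevel-suc zero C = prop-hlevel zero (contr→prop C)
  isOfHLevel-suc (suc h) H x y = isOfHLevel-suc h (H x y)

  isOfHLevel→isProp1 : {A : Set a} → isOfHLevel 1 A → isProp A
  isOfHLevel→isProp1 H x y = proj₁ (H x y)

  Σ≡-retract : {A : Set a} {B : A → Set b} {u v : Σ A B}
    → Σ (proj₁ u ≡ proj₁ v) (λ p → subst B p (proj₂ u) ≡ proj₂ v) → u ≡ v
  Σ≡-retract (refl , refl) = refl

  Σ≡-section : {A : Set a} {B : A → Set b} {u v : Σ A B}
    → u ≡ v → Σ (proj₁ u ≡ proj₁ v) (λ p → subst B p (proj₂ u) ≡ proj₂ v)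
  Σ≡-section refl = refl , refl

  Σ≡-ε : {A : Set a} {B : A → Set b} {u v : Σ A B} (e : u ≡ v)
    → Σ≡-retract {B = B} (Σ≡-section e) ≡ e
  Σ≡-ε refl = refl

  Σ-hlevel : {A : Set a} {B : A → Set b} (h : ℕ)
    → isOfHLevel h A → (∀ x → isOfHLevel h (B x)) → isOfHLevel h (Σ A B)
  Σ-hlevel {B = B} zero (c , k) HB =
    (c , proj₁ (HB c)) , λ { (x , y) → Σ≡-retract (k x , contr→prop (HB x) _ y) }
  Σ-hlevel {B = B} (suc h) HA HB u v =
    retract-hlevel h Σ≡-retract Σ≡-section Σ≡-ε
      (Σ-hlevel h (HA (proj₁ u) (proj₁ v)) (λ p → HB (proj₁ v) _ _))

module _ (fe : FunExt) where
  private
    Π-prop : {A : Set a} {B : A → Set b} → (∀ x → isProp (B x)) → isProp ((x : A) → B x)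
    Π-prop P f g = fe λ x → P x (f x) (g x)

    ×-prop : {A : Set a} {B : Set b} → isProp A → isProp B → isProp (A × B)
    ×-prop PA PB (x , y) (x' , y') with PA x x' | PB y y'
    ... | refl | refl = refl

    isContr-prop : {A : Set a} → isProp (isContr A)
    isContr-prop {A = A} (c , k) (c' , k') with k c'
    ... | refl = cong (c ,_) (Π-prop (λ x → prop→set (contr→prop (c , k)) c x) k k')

    isOfHLevel-prop : {A : Set a} (h : ℕ) → isProp (isOfHLevel h A)
    isOfHLevel-prop zero = isContr-prop
    isOfHLevel-prop (suc h) = Π-prop λ x → Π-prop λ y → isOfHLevel-prop h

    isItN-prop : {ℓ : Level} (n : ℕ) (x : V∞ ℓ) → isProp (isItN n x)
    isItN-prop n (sup∞ A f) =
      ×-prop (Π-prop λ y → isOfHLevel-prop (suc n))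
             (Π-prop λ x → isItN-prop n (f x))

    -- fibers of proj₁ ∘ f are retracts of Σ (p : isIt x) (fiber f (x , p))
    comp-trunc : {ℓ : Level} (n : ℕ) {A : Set ℓ} (f : A → V {ℓ} n)
      → isTruncMap (suc n) f → isTruncMap (suc n) (λ a → proj₁ (f a))
    comp-trunc {ℓ} n {A} f tf x =
      retract-hlevel (suc n) (r {x}) (s {x}) (rs {x})
        (Σ-hlevel (suc n) (prop-hlevel n (isItN-prop n x)) (λ p → tf (x , p)))
      where
        r : ∀ {y} → Σ (isItN n y) (λ p → fiber f (y , p)) → fiber {B = V∞ ℓ} (λ a → proj₁ (f a)) y
        r (p , a , e) = a , cong proj₁ e
        s : ∀ {y} → fiber (λ a → proj₁ (f a)) y → Σ (isItN n y) (λ p → fiber f (y , p))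
        s (a , refl) = proj₂ (f a) , a , refl
        rs : ∀ {y} (w : fiber (λ a → proj₁ (f a)) y) → r (s w) ≡ w
        rs (a , refl) = refl

  supN : {ℓ : Level} (n : ℕ) → T {ℓ} n (V {ℓ} n) → V {ℓ} n
  supN n (A , f , tf) =
    sup∞ A (λ a → proj₁ (f a)) , comp-trunc n f tf , (λ a → proj₂ (f a))

{-# OPTIONS --without-K #-}
-- The inverse of supⁿ splits an element sup∞ A g of Vⁿ into the pair of A and
-- a ↦ (g a , proof that g a is iterative): the fibers of this map are those of
-- g, because being iterative is a proposition, so it is again (n-1)-truncated.
-- Since truncatedness is a proposition as well, supⁿ and this map are mutually
-- inverse, and the coherence needed for contractible fibers holds because the
-- only non-trivial path involved lies in a proposition.
module Submission where

open import Defs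
open import Level using (Level)
open import Data.Nat using (ℕ; zero; suc)
open import Data.Product using (Σ; _×_; _,_; proj₁; proj₂)
open import Relation.Binary.PropositionalEquality using (_≡_; refl; sym; trans; cong)

private
  variable
    a b c : Level
    A B C : Set a

isContr→isProp : isContr A → isProp A
isContr→isProp (c , k) x y = trans (sym (k x)) (k y)

isProp→isProp≡ : isProp A → (x y : A) → isProp (x ≡ y)
isProp→isProp≡ P x y p q = trans (sym (canonical p)) (canonical q)
  where
    cancel : ∀ {z} (e : x ≡ z) → trans (sym e) e ≡ refl
    cancel refl = refl

    canonical : ∀ {z} (p : x ≡ z) → trans (sym (P x x)) (P x z) ≡ p
    canonical refl = cancel (P x x)

×-isProp : isProp A → isProp B → isProp (A × B)
×-isProp PA PB (x , y) (x′ , y′) with PA x x′ | PB y y′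
... | refl | refl = refl

retract-isOfHLevel : (h : ℕ) (r : A → B) (s : B → A) → (∀ y → r (s y) ≡ y)
  → isOfHLevel h A → isOfHLevel h B
retract-isOfHLevel zero r s rs (c , k) = r c , λ y → trans (cong r (k (s y))) (rs y)
retract-isOfHLevel (suc h) r s rs H x y =
  retract-isOfHLevel h
    (λ p → trans (sym (rs x)) (trans (cong r p) (rs y)))
    (cong s)
    (λ { refl → cancel (rs x) })
    (H (s x) (s y))
  where
    cancel : ∀ {z w : B} (e : z ≡ w) → trans (sym e) (trans refl e) ≡ refl
    cancel refl = refl

isEquiv-fromCanonicalPreimages : {f : A → B} (g : B → A) (ε : ∀ y → f (g y) ≡ y)
  → (∀ x → _≡_ {A = fiber f (f x)} (g (f x) , ε (f x)) (x , refl))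
  → isEquiv f
isEquiv-fromCanonicalPreimages g ε η y = (g y , ε y) , λ { (x , refl) → η x }

fiber-cong-≡-refl : {P : Set a} {Q : Set b} → isProp P → isProp Q
  → (h : P → Q) (m : Q → C) {p p′ : P} (q : h p′ ≡ h p)
  → _≡_ {A = fiber (λ x → m (h x)) (m (h p))} (p′ , cong m q) (p , refl)
fiber-cong-≡-refl PP PQ h m {p} {p′} q with PP p′ p
... | refl = cong (λ e → p , cong m e) (isProp→isProp≡ PQ (h p) (h p) q refl)

isTruncMap-pairProp : {X : Set a} {B : X → Set b} {C : Set c} → (∀ x → isProp (B x))
  → (h : ℕ) (g : C → X) (σ : ∀ z → B (g z))
  → isTruncMap h g → isTruncMap h {B = Σ X B} (λ z → g z , σ z)
isTruncMap-pairProp {X = X} {B = B} {C = C} PB h g σ tg (x , p) =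
  retract-isOfHLevel h r s rs (tg x)
  where
    gσ : C → Σ X B
    gσ z = g z , σ z

    r : fiber g x → fiber gσ (x , p)
    r (z , refl) = z , cong (g z ,_) (PB (g z) (σ z) p)

    s : fiber gσ (x , p) → fiber g x
    s (z , e) = z , cong proj₁ e

    rs : ∀ w → r (s w) ≡ w
    rs (z , refl) =
      cong (λ e → z , cong (g z ,_) e)
           (isProp→isProp≡ (PB (g z)) (σ z) (σ z) (PB (g z) (σ z) (σ z)) refl)

module _ (fe : FunExt) where

  Π-isProp : {B : A → Set b} → (∀ x → isProp (B x)) → isProp ((x : A) → B x)
  Π-isProp P f g = fe λ x → P x (f x) (g x)

  isContr-isProp : isProp (isContr A)
  isContr-isProp (c , k) (c′ , k′) with k c′
  ... | refl = cong (c ,_) (Π-isProp (isProp→isProp≡ (isContr→isProp (c , k)) c) k k′)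

  isOfHLevel-isProp : (h : ℕ) → isProp (isOfHLevel h A)
  isOfHLevel-isProp zero = isContr-isProp
  isOfHLevel-isProp (suc h) = Π-isProp λ x → Π-isProp λ y → isOfHLevel-isProp h

  isTruncMap-isProp : (h : ℕ) (f : A → B) → isProp (isTruncMap h f)
  isTruncMap-isProp h f = Π-isProp λ y → isOfHLevel-isProp h

  isItN-isProp : {ℓ : Level} (n : ℕ) (x : V∞ ℓ) → isProp (isItN n x)
  isItN-isProp n (sup∞ A f) =
    ×-isProp (isTruncMap-isProp (suc n) f) (Π-isProp λ x → isItN-isProp n (f x))

  module _ {ℓ : Level} (n : ℕ) where

    desupN : V {ℓ} n → T {ℓ} n (V n)
    desupN (sup∞ A g , tg , ig) =
      A , (λ a → g a , ig a) , isTruncMap-pairProp (isItN-isProp n) (suc n) g ig tg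

    supN-desupN : ∀ v → supN fe n (desupN v) ≡ v
    supN-desupN (sup∞ A g , tg , ig) =
      cong (λ t → sup∞ A g , t , ig) (isTruncMap-isProp (suc n) g _ tg)

    -- desupN (supN (A , f , t)) is (A , f , t′) up to η, so only the
    -- truncatedness proofs t′ and t differ.
    desupN-supN-canonical : ∀ x → _≡_ {A = fiber (supN fe n) (supN fe n x)}
      (desupN (supN fe n x) , supN-desupN (supN fe n x)) (x , refl)
    desupN-supN-canonical (A , f , t) =
      cong (λ { (t′ , e) → (A , f , t′) , e })
        (fiber-cong-≡-refl (isTruncMap-isProp (suc n) f)
                           (isTruncMap-isProp (suc n) (λ a → proj₁ (f a)))
                           (λ t′ → proj₁ (proj₂ (supN fe n (A , f , t′))))
                           (λ t′ → sup∞ A (λ a → proj₁ (f a)) , t′ , (λ a → proj₂ (f a)))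
                           _)

mainTheorem2 : (fe : FunExt) (ℓ : Level) → Univalence ℓ → (n : ℕ)
    → isEquiv (supN fe {ℓ} n)
mainTheorem2 fe ℓ _ n =
  isEquiv-fromCanonicalPreimages (desupN fe n) (supN-desupN fe n) (desupN-supN-canonical fe n)
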